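{- Let $\mathbb{K}$ be a field of characteristic zero and let $(s_n(x))_{n\in\mathbb{N}}$ be a sequence of polynomials with $s_n(x)=\sum_{k=0}^ns_{n,k}x^k$. Then $(s_n(x))$ is a family of generalized Appell polynomials if and only if there are three sequences $(f_n),(g_n),(h_n)$ in $\mathbb{K}$ with $f_0\neq0$, $g_0\neq0$ and $h_n\neq0$ for all $n$, such that $s_0(x)=\frac{h_0f_0}{g_0}$ and, for all $n\ge1$, \[ s_n(x)=\frac{1}{g_0}\big(xs_{n-1}(x)\star \widehat{h}(x)\big)-\frac{g_1}{g_0}s_{n-1}(x)-\cdots-\frac{g_n}{g_0}s_0(x)+\frac{h_0f_n}{g_0}, \] where $\widehat{h}(x)=\sum_{k=1}^{\infty}\frac{h_k}{h_{k-1}}x^k$. Moreover, in this case the coefficients satisfy, for $n\ge1$: if $k\geq1$, \[ s_{n,k}=-\frac{g_1}{g_0}s_{n-1,k}-\cdots-\frac{g_n}{g_0}s_{0,k}+\frac{h_k}{h_{k-1}}s_{n-1,k-1}, \] and if $k=0$, \[ s_{n,0}=-\frac{g_1}{g_0}s_{n-1,0}-\cdots-\frac{g_n}{g_0}s_{0,0}+\frac{h_0f_n}{g_0},\qquad s_{0,0}=\frac{h_0f_0}{g_0} \] (with $s_{l,k}=0$ for $k>l$).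
   Context: $(s_n(x))$ is a family of generalized Appell polynomials if there exist $A=\sum_{n\ge0}A_nx^n$ with $A_0\neq0$, $B=\sum_{n\geq1}B_nx^n$ with $B_1\neq0$, and $\Phi=\sum_{n\ge0}\Phi_nx^n$ with $\Phi_n\neq0$ for all $n$, such that $\sum_{n\geq0}s_n(t)x^n=A(x)\Phi(tB(x))$ (formally). The Hadamard product is $\left(\sum a_nx^n\right)\star\left(\sum b_nx^n\right)=\sum a_nb_nx^n$. -}

module Defs where

open import Level using (Level; _⊔_) renaming (suc to lsuc)
open import Data.Nat using (ℕ; zero; suc; _<_; _∸_)
open import Data.Product using (Σ; _×_; _,_)
open import Relation.Nullary using (¬_)
open import Algebra.Bundles using (CommutativeRing)

-- The inverse is given as a total operation
-- whose defining law is only required on nonzero elements.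
record Field (c ℓ : Level) : Set (lsuc (c ⊔ ℓ)) where
  field
    commutativeRing : CommutativeRing c ℓ
  open CommutativeRing commutativeRing public hiding (zero)
  field
    _⁻¹      : Carrier → Carrier
    0≉1      : ¬ (0# ≈ 1#)
    inverseʳ : ∀ x → ¬ (x ≈ 0#) → x * (x ⁻¹) ≈ 1#

  infixl 7 _/_
  _/_ : Carrier → Carrier → Carrier
  x / y = x * (y ⁻¹)

  fromℕ : ℕ → Carrier
  fromℕ zero    = 0#
  fromℕ (suc n) = 1# + fromℕ n

  CharZero : Set ℓ
  CharZero = ∀ n → ¬ (fromℕ (suc n) ≈ 0#)

module Series {c ℓ : Level} (K : Field c ℓ) where
  open Field K

  -- formal power series (and polynomials) in one variable, by coefficients
  Seq : Set c
  Seq = ℕ → Carrier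

  sumTo : ℕ → (ℕ → Carrier) → Carrier
  sumTo zero    f = f 0
  sumTo (suc n) f = sumTo n f + f (suc n)

  sum1To : ℕ → (ℕ → Carrier) → Carrier
  sum1To zero    f = 0#
  sum1To (suc n) f = sum1To n f + f (suc n)

  _·_ : Seq → Seq → Seq
  (a · b) n = sumTo n (λ i → a i * b (n ∸ i))

  oneS : Seq
  oneS zero    = 1#
  oneS (suc _) = 0#

  _^S_ : Seq → ℕ → Seq
  a ^S zero  = oneS
  a ^S suc k = a · (a ^S k)

  _⋆_ : Seq → Seq → Seq
  (a ⋆ b) n = a n * b n

  xMul : Seq → Seq
  xMul a zero    = 0#
  xMul a (suc n) = a n

  _•_ : Carrier → Seq → Seq
  (r • a) n = r * a n

  _⊕_ : Seq → Seq → Seq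
  (a ⊕ b) n = a n + b n

  _⊖_ : Seq → Seq → Seq
  (a ⊖ b) n = a n - b n

  const : Carrier → Seq
  const r zero    = r
  const r (suc _) = 0#

  _≋_ : Seq → Seq → Set ℓ
  a ≋ b = ∀ n → a n ≈ b n

  -- a sequence of polynomials s_n(x) = Σ_{k=0}^{n} s n k x^k is given by its
  -- coefficient array s : ℕ → ℕ → K with s n k = 0 for k > n.
  DegreeBounded : (ℕ → Seq) → Set ℓ
  DegreeBounded s = ∀ n k → n < k → s n k ≈ 0#

  -- Generalized Appell: Σ_n s_n(t) x^n = A(x) Φ(t B(x)) formally, i.e.
  -- (comparing coefficients of x^n t^k, using Φ(tB(x)) = Σ_k Φ_k t^k B(x)^k)
  -- s n k = Φ_k [x^n] (A(x) B(x)^k).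
  IsGeneralizedAppell : (ℕ → Seq) → Set (c ⊔ ℓ)
  IsGeneralizedAppell s =
    Σ Seq λ A → Σ Seq λ B → Σ Seq λ Φ →
      ¬ (A 0 ≈ 0#) × (B 0 ≈ 0#) × ¬ (B 1 ≈ 0#) × (∀ n → ¬ (Φ n ≈ 0#)) ×
      (∀ n k → s n k ≈ Φ k * (A · (B ^S k)) n)

  hHat : Seq → Seq
  hHat h zero    = 0#
  hHat h (suc k) = h (suc k) / h k

  PolyRecursion : (ℕ → Seq) → Seq → Seq → Seq → Set ℓ
  PolyRecursion s f g h =
    (s 0 ≋ const (h 0 * f 0 / g 0)) ×
    (∀ m → s (suc m) ≋
      ((((1# / g 0) • (xMul (s m) ⋆ hHat h))
        ⊖ (λ k → sum1To (suc m) (λ j → (g j / g 0) * s (suc m ∸ j) k)))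
        ⊕ const (h 0 * f (suc m) / g 0)))

  Admissible : Seq → Seq → Seq → Set ℓ
  Admissible f g h = ¬ (f 0 ≈ 0#) × ¬ (g 0 ≈ 0#) × (∀ n → ¬ (h n ≈ 0#))

  HasRecursion : (ℕ → Seq) → Set (c ⊔ ℓ)
  HasRecursion s =
    Σ Seq λ f → Σ Seq λ g → Σ Seq λ h → Admissible f g h × PolyRecursion s f g h

  CoeffRecursion : (ℕ → Seq) → Seq → Seq → Seq → Set ℓ
  CoeffRecursion s f g h =
    (s 0 0 ≈ h 0 * f 0 / g 0) ×
    (∀ m k → s (suc m) (suc k) ≈
       (- sum1To (suc m) (λ j → (g j / g 0) * s (suc m ∸ j) (suc k)))
       + (1# / g 0) * (h (suc k) / h k) * s m k) ×
    (∀ m → s (suc m) 0 ≈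
       (- sum1To (suc m) (λ j → (g j / g 0) * s (suc m ∸ j) 0))
       + h 0 * f (suc m) / g 0)

module Submission where

-- Write column s k = Σ_n s_{n,k} x^n for the generating series of the k-th
-- coefficients.  Multiplying the polynomial recursion by g_0 and collecting
-- the coefficient of t^k shows that it says exactly (ColumnForm)
--     g · column s 0     = h_0 f,
--     g · column s (k+1) = (h_{k+1}/h_k) x column s k .
-- Since g_0 ≠ 0, g has a reciprocal series (Reciprocal), and solving these
-- equations column by column gives column s k = h_k A B^k with A = g⁻¹ f and
-- B = x g⁻¹, i.e. s is generalized Appell with Φ = h.  Conversely, for
-- s_{n,k} = Φ_k [x^n] A B^k with B = x B' and B'_0 = B_1 ≠ 0, the triple
-- f = B'⁻¹ A, g = B'⁻¹, h = Φ satisfies the column equations (AppellForm).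
-- The coefficient recursion is the polynomial recursion read entrywise.

open import Level using (Level)
import Data.Nat as Nat
open import Data.Nat using (ℕ; zero; suc; _∸_; _≤_; z≤n; _≤?_)
open import Data.Nat.Properties
  using (m≤n⇒m≤1+n; +-∸-assoc; m∸[m∸n]≡n; ∸-+-assoc; m+[n∸m]≡n; m≤n+m; m∸n+n≡m; n∸n≡0; 1+n≰n; ≤-refl)
open import Data.Product using (_×_; _,_)
open import Data.Empty using (⊥-elim)
open import Function.Bundles using (_⇔_; mk⇔; Equivalence)
open import Relation.Nullary using (¬_; yes; no)
open import Relation.Binary.Bundles using (Setoid)
import Relation.Binary.PropositionalEquality as P
import Relation.Binary.Reasoning.Setoid as SetoidReasoning
open import Defs

open Equivalence using (to; from)

module FieldFacts {c ℓ : Level} (K : Field c ℓ) where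
  open Field K
  open SetoidReasoning setoid
  open import Algebra.Properties.Group +-group using (x≈z//y; //-rightDividesˡ)

  inverseˡ : ∀ {u} → ¬ (u ≈ 0#) → u ⁻¹ * u ≈ 1#
  inverseˡ {u} u≉0 = trans (*-comm (u ⁻¹) u) (inverseʳ u u≉0)

  ⁻¹-nonzero : ∀ {u} → ¬ (u ≈ 0#) → ¬ (u ⁻¹ ≈ 0#)
  ⁻¹-nonzero {u} u≉0 u⁻¹≈0 = 0≉1 (sym (begin
    1#       ≈⟨ inverseʳ u u≉0 ⟨
    u * u ⁻¹ ≈⟨ *-congˡ u⁻¹≈0 ⟩
    u * 0#   ≈⟨ zeroʳ u ⟩
    0#       ∎))

  *-nonzero : ∀ {x y} → ¬ (x ≈ 0#) → ¬ (y ≈ 0#) → ¬ (x * y ≈ 0#)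
  *-nonzero {x} {y} x≉0 y≉0 xy≈0 = x≉0 (begin
    x              ≈⟨ *-identityʳ x ⟨
    x * 1#         ≈⟨ *-congˡ (inverseʳ y y≉0) ⟨
    x * (y * y ⁻¹) ≈⟨ *-assoc x y (y ⁻¹) ⟨
    (x * y) * y ⁻¹ ≈⟨ *-congʳ xy≈0 ⟩
    0# * y ⁻¹      ≈⟨ zeroˡ (y ⁻¹) ⟩
    0#             ∎)

  ⁻¹-cancelˡ : ∀ {u} → ¬ (u ≈ 0#) → ∀ x → u ⁻¹ * (u * x) ≈ x
  ⁻¹-cancelˡ {u} u≉0 x = begin
    u ⁻¹ * (u * x) ≈⟨ *-assoc (u ⁻¹) u x ⟨
    (u ⁻¹ * u) * x ≈⟨ *-congʳ (inverseˡ u≉0) ⟩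
    1# * x         ≈⟨ *-identityˡ x ⟩
    x              ∎

  ⁻¹-cancelʳ : ∀ {u} → ¬ (u ≈ 0#) → ∀ x → u * (u ⁻¹ * x) ≈ x
  ⁻¹-cancelʳ {u} u≉0 x = begin
    u * (u ⁻¹ * x) ≈⟨ *-assoc u (u ⁻¹) x ⟨
    (u * u ⁻¹) * x ≈⟨ *-congʳ (inverseʳ u u≉0) ⟩
    1# * x         ≈⟨ *-identityˡ x ⟩
    x              ∎

  /-*-cancel : ∀ {v} → ¬ (v ≈ 0#) → ∀ w → (w / v) * v ≈ w
  /-*-cancel {v} v≉0 w = trans (*-comm (w / v) v) (trans (*-congˡ (*-comm w (v ⁻¹))) (⁻¹-cancelʳ v≉0 w))

  scale-solve : ∀ {u x r} → ¬ (u ≈ 0#) → (u * x ≈ r) ⇔ (x ≈ u ⁻¹ * r)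
  scale-solve {u} {x} u≉0 = mk⇔
    (λ e → trans (sym (⁻¹-cancelˡ u≉0 x)) (*-congˡ e))
    (λ e → trans (*-congˡ e) (⁻¹-cancelʳ u≉0 _))

  linear-solve : ∀ {u x t r} → ¬ (u ≈ 0#) → (u * x + t ≈ r) ⇔ (x ≈ u ⁻¹ * (r - t))
  linear-solve {u} {x} {t} {r} u≉0 = mk⇔
    (λ e → to (scale-solve u≉0) (x≈z//y (u * x) t r e))
    (λ e → trans (+-congʳ (from (scale-solve u≉0) e)) (//-rightDividesˡ t r))

module FiniteSums {c ℓ : Level} (K : Field c ℓ) where
  open Field K
  open Series K
  open SetoidReasoning setoid
  open import Algebra.Properties.CommutativeSemigroup +-commutativeSemigroup using (interchange)

  sumTo-congB : ∀ n {f g : ℕ → Carrier} → (∀ i → i ≤ n → f i ≈ g i) → sumTo n f ≈ sumTo n g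
  sumTo-congB zero    e = e 0 z≤n
  sumTo-congB (suc n) e = +-cong (sumTo-congB n (λ i i≤n → e i (m≤n⇒m≤1+n i≤n))) (e (suc n) ≤-refl)

  sumTo-cong : ∀ n {f g : ℕ → Carrier} → (∀ i → f i ≈ g i) → sumTo n f ≈ sumTo n g
  sumTo-cong n e = sumTo-congB n (λ i _ → e i)

  sum1To-cong : ∀ n {f g : ℕ → Carrier} → (∀ i → f i ≈ g i) → sum1To n f ≈ sum1To n g
  sum1To-cong zero    e = refl
  sum1To-cong (suc n) e = +-cong (sum1To-cong n e) (e (suc n))

  sumTo-+ : ∀ n (f g : ℕ → Carrier) → sumTo n (λ i → f i + g i) ≈ sumTo n f + sumTo n g
  sumTo-+ zero    f g = refl
  sumTo-+ (suc n) f g = trans (+-congʳ (sumTo-+ n f g)) (interchange _ _ _ _)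

  sumTo-*ˡ : ∀ n r (f : ℕ → Carrier) → r * sumTo n f ≈ sumTo n (λ i → r * f i)
  sumTo-*ˡ zero    r f = refl
  sumTo-*ˡ (suc n) r f = trans (distribˡ r _ _) (+-congʳ (sumTo-*ˡ n r f))

  sum1To-*ˡ : ∀ n r (f : ℕ → Carrier) → r * sum1To n f ≈ sum1To n (λ i → r * f i)
  sum1To-*ˡ zero    r f = zeroʳ r
  sum1To-*ˡ (suc n) r f = trans (distribˡ r _ _) (+-congʳ (sum1To-*ˡ n r f))

  sumTo-*ʳ : ∀ n r (f : ℕ → Carrier) → sumTo n f * r ≈ sumTo n (λ i → f i * r)
  sumTo-*ʳ zero    r f = refl
  sumTo-*ʳ (suc n) r f = trans (distribʳ r _ _) (+-congʳ (sumTo-*ʳ n r f))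

  sumTo-zero : ∀ n (f : ℕ → Carrier) → (∀ i → f i ≈ 0#) → sumTo n f ≈ 0#
  sumTo-zero zero    f e = e 0
  sumTo-zero (suc n) f e = trans (+-cong (sumTo-zero n f e) (e (suc n))) (+-identityˡ 0#)

  sumTo-shift : ∀ n (f : ℕ → Carrier) → sumTo (suc n) f ≈ f 0 + sumTo n (λ i → f (suc i))
  sumTo-shift zero    f = refl
  sumTo-shift (suc n) f = trans (+-congʳ (sumTo-shift n f)) (+-assoc _ _ _)

  sumTo-split1 : ∀ n (f : ℕ → Carrier) → sumTo n f ≈ f 0 + sum1To n f
  sumTo-split1 zero    f = sym (+-identityʳ (f 0))
  sumTo-split1 (suc n) f = trans (+-congʳ (sumTo-split1 n f)) (+-assoc _ _ _)

  private
    suc∸ : ∀ {n i} → i ≤ n → suc n ∸ i P.≡ suc (n ∸ i)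
    suc∸ i≤n = +-∸-assoc 1 i≤n

  sumTo-reverse : ∀ n (f : ℕ → Carrier) → sumTo n f ≈ sumTo n (λ i → f (n ∸ i))
  sumTo-reverse zero    f = refl
  sumTo-reverse (suc n) f = sym (begin
    sumTo n (λ i → f (suc n ∸ i)) + f (n ∸ n)
      ≈⟨ +-cong (sumTo-congB n (λ i i≤n → reflexive (P.cong f (suc∸ i≤n))))
                (reflexive (P.cong f (n∸n≡0 n))) ⟩
    sumTo n (λ i → f (suc (n ∸ i))) + f 0
      ≈⟨ +-congʳ (sumTo-reverse n (λ i → f (suc i))) ⟨
    sumTo n (λ i → f (suc i)) + f 0 ≈⟨ +-comm _ _ ⟩
    f 0 + sumTo n (λ i → f (suc i)) ≈⟨ sumTo-shift n f ⟨
    sumTo (suc n) f ∎)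

  sumTo-triangle : ∀ N (F : ℕ → ℕ → Carrier) →
    sumTo N (λ i → sumTo (N ∸ i) (F i)) ≈ sumTo N (λ l → sumTo l (λ i → F i (l ∸ i)))
  sumTo-triangle zero    F = refl
  sumTo-triangle (suc N) F = begin
    sumTo N (λ i → sumTo (suc N ∸ i) (F i)) + sumTo (N ∸ N) (F (suc N))
      ≈⟨ +-cong (sumTo-congB N (λ i i≤N → reflexive (P.cong (λ m → sumTo m (F i)) (suc∸ i≤N))))
                (reflexive (P.cong (λ m → sumTo m (F (suc N))) (n∸n≡0 N))) ⟩
    sumTo N (λ i → sumTo (N ∸ i) (F i) + F i (suc (N ∸ i))) + F (suc N) 0
      ≈⟨ +-congʳ (sumTo-+ N _ _) ⟩
    (sumTo N (λ i → sumTo (N ∸ i) (F i)) + sumTo N (λ i → F i (suc (N ∸ i)))) + F (suc N) 0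
      ≈⟨ +-assoc _ _ _ ⟩
    sumTo N (λ i → sumTo (N ∸ i) (F i)) + (sumTo N (λ i → F i (suc (N ∸ i))) + F (suc N) 0)
      ≈⟨ +-cong (sumTo-triangle N F)
           (+-cong (sumTo-congB N (λ i i≤N → reflexive (P.cong (F i) (P.sym (suc∸ i≤N)))))
                   (reflexive (P.cong (F (suc N)) (P.sym (n∸n≡0 N))))) ⟩
    sumTo N (λ l → sumTo l (λ i → F i (l ∸ i))) + sumTo (suc N) (λ i → F i (suc N ∸ i)) ∎

module SeriesAlgebra {c ℓ : Level} (K : Field c ℓ) where
  open Field K
  open Series K
  open FiniteSums K
  open SetoidReasoning setoid

  ≋-setoid : Setoid c ℓ
  ≋-setoid = record
    { Carrier = Seq
    ; _≈_ = _≋_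
    ; isEquivalence = record
      { refl = λ n → refl ; sym = λ e n → sym (e n) ; trans = λ e e′ n → trans (e n) (e′ n) } }

  open Setoid ≋-setoid public using () renaming (refl to ≋-refl; sym to ≋-sym; trans to ≋-trans)

  ·-cong : ∀ {a a′ b b′} → a ≋ a′ → b ≋ b′ → (a · b) ≋ (a′ · b′)
  ·-cong ea eb n = sumTo-cong n (λ i → *-cong (ea i) (eb (n ∸ i)))

  •-congʳ : ∀ {r a b} → a ≋ b → (r • a) ≋ (r • b)
  •-congʳ e n = *-congˡ (e n)

  •-congˡ : ∀ {r t a} → r ≈ t → (r • a) ≋ (t • a)
  •-congˡ e n = *-congʳ e

  •-assoc : ∀ r t a → (r • (t • a)) ≋ ((r * t) • a)
  •-assoc r t a n = sym (*-assoc r t (a n))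

  xMul-cong : ∀ {a b} → a ≋ b → xMul a ≋ xMul b
  xMul-cong e zero    = refl
  xMul-cong e (suc n) = e n

  xMul-• : ∀ r a → xMul (r • a) ≋ (r • xMul a)
  xMul-• r a zero    = sym (zeroʳ r)
  xMul-• r a (suc n) = refl

  ·-comm : ∀ a b → (a · b) ≋ (b · a)
  ·-comm a b n = trans (sumTo-reverse n _)
    (sumTo-congB n (λ i i≤n → trans (*-comm _ _) (*-congʳ (reflexive (P.cong b (m∸[m∸n]≡n i≤n))))))

  ·-assoc : ∀ a b d → ((a · b) · d) ≋ (a · (b · d))
  ·-assoc a b d n = begin
    sumTo n (λ l → sumTo l (λ i → a i * b (l ∸ i)) * d (n ∸ l))
      ≈⟨ sumTo-cong n (λ l → sumTo-*ʳ l _ _) ⟩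
    sumTo n (λ l → sumTo l (λ i → (a i * b (l ∸ i)) * d (n ∸ l)))
      ≈⟨ sumTo-congB n (λ l _ → sumTo-congB l (λ i i≤l →
            trans (*-assoc _ _ _) (*-congˡ (*-congˡ (reflexive (P.cong d (index i≤l))))))) ⟩
    sumTo n (λ l → sumTo l (λ i → a i * (b (l ∸ i) * d (n ∸ i ∸ (l ∸ i)))))
      ≈⟨ sumTo-triangle n (λ i j → a i * (b j * d (n ∸ i ∸ j))) ⟨
    sumTo n (λ i → sumTo (n ∸ i) (λ j → a i * (b j * d (n ∸ i ∸ j))))
      ≈⟨ sumTo-cong n (λ i → sumTo-*ˡ (n ∸ i) (a i) _) ⟨
    sumTo n (λ i → a i * sumTo (n ∸ i) (λ j → b j * d (n ∸ i ∸ j))) ∎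
    where
    index : ∀ {i l} → i ≤ l → n ∸ l P.≡ n ∸ i ∸ (l ∸ i)
    index {i} {l} i≤l = P.trans (P.cong (n ∸_) (P.sym (m+[n∸m]≡n i≤l))) (P.sym (∸-+-assoc n i (l ∸ i)))

  ·-leftComm : ∀ a b d → (a · (b · d)) ≋ (b · (a · d))
  ·-leftComm a b d = ≋-trans (≋-sym (·-assoc a b d)) (≋-trans (·-cong (·-comm a b) (≋-refl {d})) (·-assoc b a d))

  ·-xMulˡ : ∀ a b → (xMul a · b) ≋ xMul (a · b)
  ·-xMulˡ a b zero    = zeroˡ (b 0)
  ·-xMulˡ a b (suc n) = trans (sumTo-shift n _) (trans (+-congʳ (zeroˡ _)) (+-identityˡ _))

  ·-xMulʳ : ∀ a b → (a · xMul b) ≋ xMul (a · b)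
  ·-xMulʳ a b = ≋-trans (·-comm a (xMul b)) (≋-trans (·-xMulˡ b a) (xMul-cong (·-comm b a)))

  ·-oneˡ : ∀ a → (oneS · a) ≋ a
  ·-oneˡ a zero    = *-identityˡ (a 0)
  ·-oneˡ a (suc n) = trans (sumTo-shift n _)
    (trans (+-cong (*-identityˡ _) (sumTo-zero n _ (λ i → zeroˡ _))) (+-identityʳ _))

  ·-oneʳ : ∀ a → (a · oneS) ≋ a
  ·-oneʳ a = ≋-trans (·-comm a oneS) (·-oneˡ a)

  ·-•ˡ : ∀ r a b → ((r • a) · b) ≋ (r • (a · b))
  ·-•ˡ r a b n = trans (sumTo-cong n (λ i → *-assoc r _ _)) (sym (sumTo-*ˡ n r _))

  ·-•ʳ : ∀ r a b → (a · (r • b)) ≋ (r • (a · b))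
  ·-•ʳ r a b = ≋-trans (·-comm a (r • b)) (≋-trans (·-•ˡ r b a) (•-congʳ (·-comm b a)))

  ·-inverse-cancel : ∀ {g g′} → (g · g′) ≋ oneS → ∀ X → (g · (g′ · X)) ≋ X
  ·-inverse-cancel {g} {g′} gg′≋1 X =
    ≋-trans (≋-sym (·-assoc g g′ X)) (≋-trans (·-cong gg′≋1 (≋-refl {X})) (·-oneˡ X))

-- A series with invertible constant term has a reciprocal.  Its coefficients
-- b_n are determined by b_0 = a_0⁻¹ and Σ_{j≤n+1} b_j a_{n+1-j} = 0.
module Reciprocal {c ℓ : Level} (K : Field c ℓ) where
  open Field K
  open Series K
  open FieldFacts K
  open FiniteSums K
  open SeriesAlgebra K
  open SetoidReasoning setoid
  open import Algebra.Properties.Ring ring using (-‿distribˡ-*)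

  nextCoeff : Seq → ℕ → Seq → Carrier
  nextCoeff a n b = - (a 0 ⁻¹ * sumTo n (λ j → b j * a (suc n ∸ j)))

  -- approx a n holds the coefficients b_0, …, b_n of 1/a (and junk beyond)
  approx : Seq → ℕ → Seq
  approx a zero    _ = a 0 ⁻¹
  approx a (suc n) i with i ≤? n
  ... | yes _ = approx a n i
  ... | no  _ = nextCoeff a n (approx a n)

  recip : Seq → Seq
  recip a i = approx a i i

  approx-stable : ∀ a d i → approx a (d Nat.+ i) i P.≡ recip a i
  approx-stable a zero    i = P.refl
  approx-stable a (suc d) i with i ≤? d Nat.+ i
  ... | yes _   = approx-stable a d i
  ... | no  i≰d+i = ⊥-elim (i≰d+i (m≤n+m i d))

  approx-agrees : ∀ a n j → j ≤ n → approx a n j P.≡ recip a j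
  approx-agrees a n j j≤n = P.subst (λ m → approx a m j P.≡ recip a j) (m∸n+n≡m j≤n) (approx-stable a (n ∸ j) j)

  recip-suc : ∀ a n → recip a (suc n) P.≡ nextCoeff a n (approx a n)
  recip-suc a n with suc n ≤? n
  ... | yes n+1≤n = ⊥-elim (1+n≰n n+1≤n)
  ... | no  _     = P.refl

  -- degree n+1 of (1/a) a vanishes by the choice of b_{n+1}
  recip-inverseˡ : ∀ a → ¬ (a 0 ≈ 0#) → (recip a · a) ≋ oneS
  recip-inverseˡ a a₀≉0 zero    = inverseˡ a₀≉0
  recip-inverseˡ a a₀≉0 (suc n) = begin
    sumTo n (λ i → recip a i * a (suc n ∸ i)) + recip a (suc n) * a (n ∸ n)
      ≈⟨ +-cong (sumTo-congB n (λ i i≤n → *-congʳ (reflexive (P.sym (approx-agrees a n i i≤n)))))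
                (*-cong (reflexive (recip-suc a n)) (reflexive (P.cong a (n∸n≡0 n)))) ⟩
    Y + - (a 0 ⁻¹ * Y) * a 0    ≈⟨ +-congˡ (-‿distribˡ-* _ _) ⟨
    Y + - (a 0 ⁻¹ * Y * a 0)    ≈⟨ +-congˡ (-‿cong (trans (*-comm _ _) (⁻¹-cancelʳ a₀≉0 Y))) ⟩
    Y + - Y                     ≈⟨ -‿inverseʳ Y ⟩
    0#                          ∎
    where
    Y : Carrier
    Y = sumTo n (λ j → approx a n j * a (suc n ∸ j))

  recip-inverseʳ : ∀ a → ¬ (a 0 ≈ 0#) → (a · recip a) ≋ oneS
  recip-inverseʳ a a₀≉0 = ≋-trans (·-comm a (recip a)) (recip-inverseˡ a a₀≉0)

module ColumnForm {c ℓ : Level} (K : Field c ℓ) where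
  open Field K
  open Series K
  open FieldFacts K
  open FiniteSums K
  open SeriesAlgebra K using (≋-trans; •-congʳ)
  open SetoidReasoning setoid
  open import Algebra.Properties.Ring ring using (x[y-z]≈xy-xz)

  column : (ℕ → Seq) → ℕ → Seq
  column s k n = s n k

  columnRHS : (ℕ → Seq) → Seq → Seq → ℕ → Seq
  columnRHS s f h zero    = h 0 • f
  columnRHS s f h (suc k) = (h (suc k) / h k) • xMul (column s k)

  ColumnRecursion : (ℕ → Seq) → Seq → Seq → Seq → Set ℓ
  ColumnRecursion s f g h = ∀ k → (g · column s k) ≋ columnRHS s f h k

  ColumnRecursion-cong : ∀ {s f f′ g h} → f ≋ f′ → ColumnRecursion s f g h → ColumnRecursion s f′ g h
  ColumnRecursion-cong f≋f′ columns zero    = ≋-trans (columns 0) (•-congʳ f≋f′)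
  ColumnRecursion-cong f≋f′ columns (suc k) = columns (suc k)

  lowerTerms : (ℕ → Seq) → Seq → ℕ → ℕ → Carrier
  lowerTerms s g m k = sum1To (suc m) (λ j → g j * s (suc m ∸ j) k)

  polyRHS : (ℕ → Seq) → Seq → Seq → Seq → ℕ → Seq
  polyRHS s f g h m =
    (((1# / g 0) • (xMul (s m) ⋆ hHat h))
      ⊖ (λ k → sum1To (suc m) (λ j → (g j / g 0) * s (suc m ∸ j) k)))
      ⊕ const (h 0 * f (suc m) / g 0)

  column-convolution : ∀ (s : ℕ → Seq) (g : Seq) m k → (g · column s k) (suc m) ≈ g 0 * s (suc m) k + lowerTerms s g m k
  column-convolution s g m k = sumTo-split1 (suc m) _

  initial-entry : ∀ (s : ℕ → Seq) (f g h : Seq) k → const (h 0 * f 0 / g 0) k ≈ g 0 ⁻¹ * columnRHS s f h k 0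
  initial-entry s f g h zero    = *-comm _ _
  initial-entry s f g h (suc k) = sym (trans (*-congˡ (zeroʳ _)) (zeroʳ _))

  scaled-lowerTerms : ∀ (s : ℕ → Seq) (g : Seq) m k →
    sum1To (suc m) (λ j → (g j / g 0) * s (suc m ∸ j) k) ≈ g 0 ⁻¹ * lowerTerms s g m k
  scaled-lowerTerms s g m k = sym (trans (sum1To-*ˡ (suc m) (g 0 ⁻¹) _)
    (sum1To-cong (suc m) (λ j → trans (sym (*-assoc _ _ _)) (*-congʳ (*-comm (g 0 ⁻¹) (g j))))))

  recursion-entry : ∀ (s : ℕ → Seq) (f g h : Seq) m k →
    polyRHS s f g h m k ≈ g 0 ⁻¹ * (columnRHS s f h k (suc m) - lowerTerms s g m k)
  recursion-entry s f g h m zero = begin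
    ((1# / g 0) * (0# * 0#) - Q) + h 0 * f (suc m) / g 0
      ≈⟨ +-congʳ (+-congʳ (trans (*-congˡ (zeroˡ 0#)) (zeroʳ _))) ⟩
    (0# - Q) + h 0 * f (suc m) / g 0   ≈⟨ +-congʳ (+-identityˡ _) ⟩
    - Q + h 0 * f (suc m) / g 0        ≈⟨ +-comm _ _ ⟩
    h 0 * f (suc m) / g 0 - Q          ≈⟨ +-cong (*-comm _ _) (-‿cong (scaled-lowerTerms s g m 0)) ⟩
    g 0 ⁻¹ * (h 0 * f (suc m)) - g 0 ⁻¹ * lowerTerms s g m 0 ≈⟨ x[y-z]≈xy-xz _ _ _ ⟨
    g 0 ⁻¹ * (h 0 * f (suc m) - lowerTerms s g m 0) ∎
    where
    Q : Carrier
    Q = sum1To (suc m) (λ j → (g j / g 0) * s (suc m ∸ j) 0)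
  recursion-entry s f g h m (suc k) = begin
    ((1# / g 0) * (s m k * r) - Q) + 0#   ≈⟨ +-identityʳ _ ⟩
    (1# / g 0) * (s m k * r) - Q
      ≈⟨ +-cong (*-cong (*-identityˡ _) (*-comm _ _)) (-‿cong (scaled-lowerTerms s g m (suc k))) ⟩
    g 0 ⁻¹ * (r * s m k) - g 0 ⁻¹ * lowerTerms s g m (suc k) ≈⟨ x[y-z]≈xy-xz _ _ _ ⟨
    g 0 ⁻¹ * (r * s m k - lowerTerms s g m (suc k)) ∎
    where
    r Q : Carrier
    r = h (suc k) / h k
    Q = sum1To (suc m) (λ j → (g j / g 0) * s (suc m ∸ j) (suc k))

  poly⇔columns : ∀ (s : ℕ → Seq) (f g h : Seq) → ¬ (g 0 ≈ 0#) → PolyRecursion s f g h ⇔ ColumnRecursion s f g h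
  poly⇔columns s f g h g₀≉0 = mk⇔ toColumns fromColumns
    where
    toColumns : PolyRecursion s f g h → ColumnRecursion s f g h
    toColumns (initial , step) k zero =
      from (scale-solve g₀≉0) (trans (initial k) (initial-entry s f g h k))
    toColumns (initial , step) k (suc m) = trans (column-convolution s g m k)
      (from (linear-solve g₀≉0) (trans (step m k) (recursion-entry s f g h m k)))

    fromColumns : ColumnRecursion s f g h → PolyRecursion s f g h
    fromColumns columns =
      (λ k → trans (to (scale-solve g₀≉0) (columns k 0)) (sym (initial-entry s f g h k))) ,
      (λ m k → trans (to (linear-solve g₀≉0) (trans (sym (column-convolution s g m k)) (columns k (suc m))))
                     (sym (recursion-entry s f g h m k)))

module AppellForm {c ℓ : Level} (K : Field c ℓ) where
  open Field K
  open Series K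
  open FieldFacts K
  open SeriesAlgebra K
  open ColumnForm K
  open SetoidReasoning ≋-setoid

  AppellColumns : (ℕ → Seq) → Seq → Seq → Seq → Set ℓ
  AppellColumns s A B Φ = ∀ k → column s k ≋ (Φ k • (A · (B ^S k)))

  columnRHS-suc : ∀ (s : ℕ → Seq) (f Φ : Seq) k {X} → ¬ (Φ k ≈ 0#) → column s k ≋ (Φ k • X) →
    columnRHS s f Φ (suc k) ≋ (Φ (suc k) • xMul X)
  columnRHS-suc s f Φ k {X} Φₖ≉0 columnₖ = begin
    r • xMul (column s k)  ≈⟨ •-congʳ (xMul-cong columnₖ) ⟩
    r • xMul (Φ k • X)     ≈⟨ •-congʳ (xMul-• (Φ k) X) ⟩
    r • (Φ k • xMul X)     ≈⟨ •-assoc r (Φ k) (xMul X) ⟩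
    (r * Φ k) • xMul X     ≈⟨ •-congˡ (/-*-cancel Φₖ≉0 (Φ (suc k))) ⟩
    Φ (suc k) • xMul X     ∎
    where
    r : Carrier
    r = Φ (suc k) / Φ k

  appell⇔columns : ∀ {s A B g g′ Φ} → (∀ n → ¬ (Φ n ≈ 0#)) → (g · g′) ≋ oneS → B ≋ xMul g′ →
    AppellColumns s A B Φ ⇔ ColumnRecursion s (g · A) g Φ
  appell⇔columns {s} {A} {B} {g} {g′} {Φ} Φ≉0 gg′≋1 B≋xg′ = mk⇔ toColumns fromColumns
    where
    g′-shift : ∀ X → (g′ · xMul X) ≋ (B · X)
    g′-shift X = begin
      g′ · xMul X    ≈⟨ ·-xMulʳ g′ X ⟩
      xMul (g′ · X)  ≈⟨ ·-xMulˡ g′ X ⟨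
      xMul g′ · X    ≈⟨ ·-cong B≋xg′ (≋-refl {X}) ⟨
      B · X          ∎

    toColumns : AppellColumns s A B Φ → ColumnRecursion s (g · A) g Φ
    toColumns columns zero = begin
      g · column s 0          ≈⟨ ·-cong (≋-refl {g}) (columns 0) ⟩
      g · (Φ 0 • (A · oneS))  ≈⟨ ·-•ʳ (Φ 0) g (A · oneS) ⟩
      Φ 0 • (g · (A · oneS))  ≈⟨ •-congʳ (·-cong (≋-refl {g}) (·-oneʳ A)) ⟩
      Φ 0 • (g · A)           ∎
    toColumns columns (suc k) = begin
      g · column s (suc k)                    ≈⟨ ·-cong (≋-refl {g}) (columns (suc k)) ⟩
      g · (Φ (suc k) • (A · (B · Bᵏ)))        ≈⟨ ·-•ʳ (Φ (suc k)) g (A · (B · Bᵏ)) ⟩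
      Φ (suc k) • (g · (A · (B · Bᵏ)))        ≈⟨ •-congʳ (·-leftComm g A (B · Bᵏ)) ⟩
      Φ (suc k) • (A · (g · (B · Bᵏ)))        ≈⟨ •-congʳ (·-cong (≋-refl {A}) (·-cong (≋-refl {g}) (g′-shift Bᵏ))) ⟨
      Φ (suc k) • (A · (g · (g′ · xMul Bᵏ)))  ≈⟨ •-congʳ (·-cong (≋-refl {A}) (·-inverse-cancel gg′≋1 (xMul Bᵏ))) ⟩
      Φ (suc k) • (A · xMul Bᵏ)               ≈⟨ •-congʳ (·-xMulʳ A Bᵏ) ⟩
      Φ (suc k) • xMul (A · Bᵏ)               ≈⟨ columnRHS-suc s (g · A) Φ k (Φ≉0 k) (columns k) ⟨
      columnRHS s (g · A) Φ (suc k)           ∎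
      where
      Bᵏ : Seq
      Bᵏ = B ^S k

    solved : ColumnRecursion s (g · A) g Φ → ∀ k → column s k ≋ (g′ · columnRHS s (g · A) Φ k)
    solved columns k = begin
      column s k                        ≈⟨ ·-inverse-cancel (≋-trans (·-comm g′ g) gg′≋1) (column s k) ⟨
      g′ · (g · column s k)             ≈⟨ ·-cong (≋-refl {g′}) (columns k) ⟩
      g′ · columnRHS s (g · A) Φ k      ∎

    fromColumns : ColumnRecursion s (g · A) g Φ → AppellColumns s A B Φ
    fromColumns columns zero = begin
      column s 0              ≈⟨ solved columns 0 ⟩
      g′ · (Φ 0 • (g · A))    ≈⟨ ·-•ʳ (Φ 0) g′ (g · A) ⟩
      Φ 0 • (g′ · (g · A))    ≈⟨ •-congʳ (·-inverse-cancel (≋-trans (·-comm g′ g) gg′≋1) A) ⟩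
      Φ 0 • A                 ≈⟨ •-congʳ (·-oneʳ A) ⟨
      Φ 0 • (A · oneS)        ∎
    fromColumns columns (suc k) = begin
      column s (suc k)                    ≈⟨ solved columns (suc k) ⟩
      g′ · columnRHS s (g · A) Φ (suc k)  ≈⟨ ·-cong (≋-refl {g′}) (columnRHS-suc s (g · A) Φ k (Φ≉0 k) (fromColumns columns k)) ⟩
      g′ · (Φ (suc k) • xMul (A · Bᵏ))    ≈⟨ ·-•ʳ (Φ (suc k)) g′ (xMul (A · Bᵏ)) ⟩
      Φ (suc k) • (g′ · xMul (A · Bᵏ))    ≈⟨ •-congʳ (g′-shift (A · Bᵏ)) ⟩
      Φ (suc k) • (B · (A · Bᵏ))          ≈⟨ •-congʳ (·-leftComm B A Bᵏ) ⟩
      Φ (suc k) • (A · (B · Bᵏ))          ∎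
      where
      Bᵏ : Seq
      Bᵏ = B ^S k

module GeneralizedAppell {c ℓ : Level} (K : Field c ℓ) where
  open Field K
  open Series K
  open FieldFacts K
  open SeriesAlgebra K
  open Reciprocal K
  open ColumnForm K
  open AppellForm K

  recursion⇒appell : ∀ (s : ℕ → Seq) → HasRecursion s → IsGeneralizedAppell s
  recursion⇒appell s (f , g , h , (f₀≉0 , g₀≉0 , h≉0) , recursion) =
    recip g · f , xMul (recip g) , h ,
    *-nonzero (⁻¹-nonzero g₀≉0) f₀≉0 , refl , ⁻¹-nonzero g₀≉0 , h≉0 ,
    (λ n k → from (appell⇔columns h≉0 g·g⁻¹≋1 ≋-refl) columns k n)
    where
    g·g⁻¹≋1 : (g · recip g) ≋ oneS
    g·g⁻¹≋1 = recip-inverseʳ g g₀≉0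
    columns : ColumnRecursion s (g · (recip g · f)) g h
    columns = ColumnRecursion-cong (≋-sym (·-inverse-cancel g·g⁻¹≋1 f))
                (to (poly⇔columns s f g h g₀≉0) recursion)

  appell⇒recursion : ∀ (s : ℕ → Seq) → IsGeneralizedAppell s → HasRecursion s
  appell⇒recursion s (A , B , Φ , A₀≉0 , B₀≈0 , B₁≉0 , Φ≉0 , coefficients) =
    g · A , g , Φ , (*-nonzero (⁻¹-nonzero B₁≉0) A₀≉0 , ⁻¹-nonzero B₁≉0 , Φ≉0) ,
    from (poly⇔columns s (g · A) g Φ (⁻¹-nonzero B₁≉0))
      (to (appell⇔columns Φ≉0 (recip-inverseˡ B′ B₁≉0) B≋xB′) (λ k n → coefficients n k))
    where
    B′ g : Seq
    B′ n = B (suc n)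
    g = recip B′
    B≋xB′ : B ≋ xMul B′
    B≋xB′ zero    = B₀≈0
    B≋xB′ (suc n) = refl

  coefficient-recursion : ∀ (s : ℕ → Seq) (f g h : Seq) → PolyRecursion s f g h → CoeffRecursion s f g h
  coefficient-recursion s f g h (initial , step) = initial 0 , higher , constant
    where
    higher : ∀ m k → s (suc m) (suc k) ≈
      (- sum1To (suc m) (λ j → (g j / g 0) * s (suc m ∸ j) (suc k))) + (1# / g 0) * (h (suc k) / h k) * s m k
    higher m k = trans (step m (suc k)) (trans (+-identityʳ _) (trans (+-comm _ _)
      (+-congˡ (trans (*-congˡ (*-comm (s m k) _)) (sym (*-assoc _ _ _))))))
    constant : ∀ m → s (suc m) 0 ≈
      (- sum1To (suc m) (λ j → (g j / g 0) * s (suc m ∸ j) 0)) + h 0 * f (suc m) / g 0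
    constant m = trans (step m zero)
      (+-congʳ (trans (+-congʳ (trans (*-congˡ (zeroˡ 0#)) (zeroʳ _))) (+-identityˡ _)))

mainTheorem9 : ∀ {c ℓ} (K : Field c ℓ) → Field.CharZero K →
    let open Field K in
    let open Series K in
    (s : ℕ → Seq) → DegreeBounded s →
      (IsGeneralizedAppell s ⇔ HasRecursion s) ×
      (∀ f g h → Admissible f g h → PolyRecursion s f g h → CoeffRecursion s f g h)
mainTheorem9 K _ s _ =
  mk⇔ (appell⇒recursion s) (recursion⇒appell s) ,
  λ f g h _ → coefficient-recursion s f g h
  where open GeneralizedAppell K
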